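{- Let $\sim$ denote either $\cong$ or $\simeq$. A type expression $A$ is a $\top$-variant if and only if $A\sim\top$.
   Context: Pseudo type expressions: $A::=X\mid A\to B\mid \bullet A\mid \mu X.A$ over a countable set of type variables ($\alpha$-equivalent ones identified; $A[B/X]$ capture-avoiding substitution). $\top:=\mu X.\bullet X$; $\bullet^n A$ is $A$ preceded by $n$ bullets. Tail: $t(X)=X$, $t(A\to B)=t(B)$, $t(\bullet A)=\bullet t(A)$, $t(\mu X.A)=\mu X.t(A)$. $A$ is a $\top$-variant iff $t(A)=\bullet^{m_0}\mu X_1.\bullet^{m_1}\cdots\mu X_n.\bullet^{m_n}X_i$ for some $n$, $m_j\ge0$, $1\le i\le n$ with $X_i\notin\{X_{i+1},\dots,X_n\}$ and $m_i+\dots+m_n\ge1$. Properness in $X$: variable $Y$ iff $Y\ne X$; $\bullet A$ always; $A\to B$ iff both are, or $B$ is a $\top$-variant; $\mu Y.A$ ($Y\ne X$) iff $A$ is, or $\mu Y.A$ is a $\top$-variant. Type expressions: pseudo type expressions in which every $\mu X.A$ has $A$ proper in $X$. $\cong$ is the smallest relation on type expressions closed under: reflexivity, symmetry, transitivity; $A\cong B\Rightarrow\bullet A\cong\bullet B$; $A\cong C,B\cong D\Rightarrow A\to B\cong C\to D$; $A\to\top\cong\top$; $\mu X.A\cong A[\mu X.A/X]$; if $A\cong C[A/X]$ and $C$ is proper in $X$ then $A\cong\mu X.C$. $\simeq$ is defined by the same rules plus $\bullet(A\to B)\simeq\bullet A\to\bullet B$. -}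

module Defs where

open import Data.Nat using (ℕ; zero; suc; _∸_; _<_; _≤_)
open import Data.List using (List; []; _∷_; length; drop)
open import Data.Nat.ListAction using (sum)
open import Data.Product using (Σ; _×_; _,_)
open import Data.Sum using (_⊎_)
open import Data.Unit using (⊤)
open import Relation.Binary.PropositionalEquality using (_≡_; _≢_)

-- Pseudo type expressions, with α-equivalence classes represented by
-- de Bruijn indices: (var n) refers to the n-th enclosing μ binder
-- (0 = innermost); indices beyond the binders are free variables.
infixr 5 _⇒_
data Ty : Set where
  var : ℕ → Ty
  _⇒_ : Ty → Ty → Ty
  •_  : Ty → Ty
  μ   : Ty → Ty

ext : (ℕ → ℕ) → ℕ → ℕ
ext ρ zero = zero
ext ρ (suc n) = suc (ρ n)

rename : (ℕ → ℕ) → Ty → Ty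
rename ρ (var n) = var (ρ n)
rename ρ (A ⇒ B) = rename ρ A ⇒ rename ρ B
rename ρ (• A) = • rename ρ A
rename ρ (μ A) = μ (rename (ext ρ) A)

exts : (ℕ → Ty) → ℕ → Ty
exts σ zero = var zero
exts σ (suc n) = rename suc (σ n)

subst : (ℕ → Ty) → Ty → Ty
subst σ (var n) = σ n
subst σ (A ⇒ B) = subst σ A ⇒ subst σ B
subst σ (• A) = • subst σ A
subst σ (μ A) = μ (subst (exts σ) A)

-- A [ B /0] : substitute B for the variable bound by the (removed) binder
-- of body A, i.e. for μX.A this is A[B/X].
sub0 : Ty → ℕ → Ty
sub0 B zero = B
sub0 B (suc n) = var n

_[_/0] : Ty → Ty → Ty
A [ B /0] = subst (sub0 B) A

bullets : ℕ → Ty → Ty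
bullets zero A = A
bullets (suc n) A = • bullets n A

Top : Ty
Top = μ (• var zero)

tl : Ty → Ty
tl (var n) = var n
tl (A ⇒ B) = tl B
tl (• A) = • tl A
tl (μ A) = μ (tl A)

-- tailForm m₀ [m₁,…,mₙ] k  =  •^{m₀} μ •^{m₁} μ … μ •^{mₙ} (var k)
tailForm : ℕ → List ℕ → ℕ → Ty
tailForm m₀ [] k = bullets m₀ (var k)
tailForm m₀ (m ∷ ms) k = bullets m₀ (μ (tailForm m ms k))

-- A is a ⊤-variant: t(A) = •^{m₀} μX₁.•^{m₁} … μXₙ.•^{mₙ} Xᵢ with Xᵢ the
-- variable bound by the i-th binder (1 ≤ i ≤ n, i.e. de Bruijn index
-- k = n - i < n) and m_i + … + m_n ≥ 1 (= sum (drop (i-1) ms), i - 1 = n ∸ suc k).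
IsTopVariant : Ty → Set
IsTopVariant A =
  Σ ℕ λ m₀ → Σ (List ℕ) λ ms → Σ ℕ λ k →
    (k < length ms) × (1 ≤ sum (drop (length ms ∸ suc k) ms)) ×
    (tl A ≡ tailForm m₀ ms k)

Proper : ℕ → Ty → Set
Proper k (var j) = j ≢ k
Proper k (• A) = ⊤
Proper k (A ⇒ B) = (Proper k A × Proper k B) ⊎ IsTopVariant B
Proper k (μ A) = Proper (suc k) A ⊎ IsTopVariant (μ A)

-- Type expressions: every μX.A has A proper in X.
WF : Ty → Set
WF (var n) = ⊤
WF (A ⇒ B) = WF A × WF B
WF (• A) = WF A
WF (μ A) = Proper zero A × WF A

-- Which rule set: iso gives ≅, equi gives ≃ (adds •(A→B) ≃ •A→•B).
data Rules : Set where
  iso equi : Rules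

-- The relation generated by the rules, on type expressions (the base
-- rules carry well-formedness side conditions so that only type
-- expressions are related).
data Eqv (r : Rules) : Ty → Ty → Set where
  refl′  : ∀ {A} → WF A → Eqv r A A
  sym′   : ∀ {A B} → Eqv r A B → Eqv r B A
  trans′ : ∀ {A B C} → Eqv r A B → Eqv r B C → Eqv r A C
  cong•  : ∀ {A B} → Eqv r A B → Eqv r (• A) (• B)
  cong⇒  : ∀ {A B C D} → Eqv r A C → Eqv r B D → Eqv r (A ⇒ B) (C ⇒ D)
  arrTop : ∀ {A} → WF A → Eqv r (A ⇒ Top) Top
  fold   : ∀ {A} → WF (μ A) → WF (A [ μ A /0]) → Eqv r (μ A) (A [ μ A /0])
  contr  : ∀ {A C} → WF A → WF C → Proper zero C →
           Eqv r A (C [ A /0]) → Eqv r A (μ C)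
  dist•  : ∀ {A B} → r ≡ equi → WF A → WF B →
           Eqv r (• (A ⇒ B)) ((• A) ⇒ (• B))

_≅_ : Ty → Ty → Set
_≅_ = Eqv iso

_≃_ : Ty → Ty → Set
_≃_ = Eqv equi

module Submission where

-- The proof abstracts a type to the *shape* of its tail: following the result
-- type of arrows, counting bullets and unfolding μ-binders, the tail either
-- goes on forever (as for ⊤ = μX.•X) or ends after b bullets at a free
-- variable (or at an unguarded bound variable, which no type expression has).
--   1. The shape is compositional: renaming and substitution act on it by a
--      simple "bind" operation.
--   2. A type is a ⊤-variant exactly when its shape is endless; the tail
--      forms •^{m₀}μ•^{m₁}…μ•^{mₙ}Xᵢ of the definition are read off the shape.
--   3. Every rule of ≅ and ≃ preserves the shape; for the contraction rule
--      this uses that a shape with b ≥ 1 bullets is a fixed point of "add b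
--      bullets" only when it is endless.  Hence A ~ ⊤ implies A is a ⊤-variant.
--   4. Conversely, by induction on A, every type of endless shape is ≅ ⊤.
--      The μ case substitutes ⊤ for the bound variable, so the induction is
--      carried out for all substitution instances subst σ A where σ sends
--      each variable to ⊤ or to a variable; such substitutions preserve
--      well-formedness and compose.

open import Defs
open import Function using (id)
open import Function.Bundles using (_⇔_; mk⇔)
open import Data.Nat using (ℕ; zero; suc; _+_; _∸_; _<_; _≤_; z≤n; s≤s)
open import Data.Nat.Properties
  using (suc-injective; +-assoc; +-suc; +-identityʳ; +-∸-assoc; n∸n≡0;
         m<1+n⇒m<n∨m≡n; m<n⇒m<1+n; n<1+n; m≢1+n+m)
open import Data.List using (List; []; _∷_; length; drop)
open import Data.Nat.ListAction using (sum)
open import Data.Product using (Σ; _×_; _,_; proj₁; proj₂)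
open import Data.Sum using (_⊎_; inj₁; inj₂)
open import Data.Unit using (tt)
open import Data.Empty using (⊥-elim)
open import Relation.Binary.PropositionalEquality
  using (_≡_; _≢_; refl; sym; trans; cong; cong₂)
  renaming (subst to transport)

-- Where a finite tail ends: at a free variable (de Bruijn index), or at the
-- variable of an enclosing μ reached without any bullet.
data Target : Set where
  free      : ℕ → Target
  unguarded : Target

data Shape : Set where
  endless : Shape
  ends    : ℕ → Target → Shape

delay : ℕ → Shape → Shape
delay n endless    = endless
delay n (ends b t) = ends (n + b) t

-- Shape of μX.A when the tail of A reaches X after b bullets.
knot : ℕ → Shape
knot zero    = ends zero unguarded
knot (suc b) = endless

closeμ : Shape → Shape
closeμ endless                 = endless
closeμ (ends b unguarded)      = ends b unguarded
closeμ (ends b (free zero))    = knot b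
closeμ (ends b (free (suc j))) = ends b (free j)

shape : Ty → Shape
shape (var n) = ends 0 (free n)
shape (A ⇒ B) = shape B
shape (• A)   = delay 1 (shape A)
shape (μ A)   = closeμ (shape A)

renameShape : (ℕ → ℕ) → Shape → Shape
renameShape ρ endless            = endless
renameShape ρ (ends b unguarded) = ends b unguarded
renameShape ρ (ends b (free j))  = ends b (free (ρ j))

bindShape : Shape → (ℕ → Shape) → Shape
bindShape endless            g = endless
bindShape (ends b unguarded) g = ends b unguarded
bindShape (ends b (free j))  g = delay b (g j)

delay-zero : ∀ s → delay 0 s ≡ s
delay-zero endless    = refl
delay-zero (ends b t) = refl

delay-+ : ∀ m n s → delay m (delay n s) ≡ delay (m + n) s
delay-+ m n endless    = refl
delay-+ m n (ends b t) = cong (λ c → ends c t) (sym (+-assoc m n b))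

delay-bind : ∀ n s g → delay n (bindShape s g) ≡ bindShape (delay n s) g
delay-bind n endless            g = refl
delay-bind n (ends b unguarded) g = refl
delay-bind n (ends b (free j))  g = delay-+ n b (g j)

delay-rename : ∀ ρ n s → renameShape ρ (delay n s) ≡ delay n (renameShape ρ s)
delay-rename ρ n endless            = refl
delay-rename ρ n (ends b unguarded) = refl
delay-rename ρ n (ends b (free j))  = refl

closeμ-rename : ∀ ρ s → closeμ (renameShape (ext ρ) s) ≡ renameShape ρ (closeμ s)
closeμ-rename ρ endless                       = refl
closeμ-rename ρ (ends b unguarded)            = refl
closeμ-rename ρ (ends zero (free zero))       = refl
closeμ-rename ρ (ends (suc b) (free zero))    = refl
closeμ-rename ρ (ends b (free (suc j)))       = refl

shape-rename : ∀ ρ A → shape (rename ρ A) ≡ renameShape ρ (shape A)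
shape-rename ρ (var n) = refl
shape-rename ρ (A ⇒ B) = shape-rename ρ B
shape-rename ρ (• A)   =
  trans (cong (delay 1) (shape-rename ρ A)) (sym (delay-rename ρ 1 (shape A)))
shape-rename ρ (μ A)   =
  trans (cong closeμ (shape-rename (ext ρ) A)) (closeμ-rename ρ (shape A))

-- Binding commutes with closing a binder, provided the substitution under
-- the binder (h) is the lifting of the one outside it (g).
closeμ-bind : ∀ s g h → h 0 ≡ ends 0 (free 0) →
              (∀ n → h (suc n) ≡ renameShape suc (g n)) →
              closeμ (bindShape s h) ≡ bindShape (closeμ s) g
closeμ-bind endless            g h h0 hs = refl
closeμ-bind (ends b unguarded) g h h0 hs = refl
closeμ-bind (ends b (free zero)) g h h0 hs
  rewrite h0 | +-identityʳ b = knot-bind b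
  where
  knot-bind : ∀ b → knot b ≡ bindShape (knot b) g
  knot-bind zero    = refl
  knot-bind (suc b) = refl
closeμ-bind (ends b (free (suc j))) g h h0 hs
  rewrite hs j = close-shifted (g j)
  where
  close-shifted : ∀ w → closeμ (delay b (renameShape suc w)) ≡ delay b w
  close-shifted endless            = refl
  close-shifted (ends c unguarded) = refl
  close-shifted (ends c (free i))  = refl

shape-subst : ∀ σ A → shape (subst σ A) ≡ bindShape (shape A) (λ n → shape (σ n))
shape-subst σ (var n) = sym (delay-zero (shape (σ n)))
shape-subst σ (A ⇒ B) = shape-subst σ B
shape-subst σ (• A)   =
  trans (cong (delay 1) (shape-subst σ A)) (delay-bind 1 (shape A) _)
shape-subst σ (μ A)   =
  trans (cong closeμ (shape-subst (exts σ) A))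
        (closeμ-bind (shape A) (λ n → shape (σ n)) (λ n → shape (exts σ n))
                     refl (λ n → shape-rename suc (σ n)))

shape-tl : ∀ A → shape (tl A) ≡ shape A
shape-tl (var n) = refl
shape-tl (A ⇒ B) = shape-tl B
shape-tl (• A)   = cong (delay 1) (shape-tl A)
shape-tl (μ A)   = cong closeμ (shape-tl A)

shape-bullets : ∀ m A → shape (bullets m A) ≡ delay m (shape A)
shape-bullets zero    A = sym (delay-zero (shape A))
shape-bullets (suc m) A =
  trans (cong (delay 1) (shape-bullets m A)) (delay-+ 1 m (shape A))

tailForm-suc : ∀ m ms k → tailForm (suc m) ms k ≡ • tailForm m ms k
tailForm-suc m []       k = refl
tailForm-suc m (m′ ∷ ms) k = refl

shape-tailForm-free : ∀ m ms j →
  shape (tailForm m ms (j + length ms)) ≡ ends (m + sum ms) (free j)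
shape-tailForm-free m [] j =
  trans (shape-bullets m _) (cong (λ i → ends (m + 0) (free i)) (+-identityʳ j))
shape-tailForm-free m (m′ ∷ ms) j rewrite +-suc j (length ms) =
  trans (shape-bullets m _) (cong (λ s → delay m (closeμ s)) (shape-tailForm-free m′ ms (suc j)))

-- The side condition of IsTopVariant: some bullet follows the binder of the
-- target variable.
GuardedFrom : List ℕ → ℕ → Set
GuardedFrom ms k = 1 ≤ sum (drop (length ms ∸ suc k) ms)

guarded-inner : ∀ m ms k → k < length ms → GuardedFrom (m ∷ ms) k ≡ GuardedFrom ms k
guarded-inner m ms k k<n = cong (λ i → 1 ≤ sum (drop i (m ∷ ms))) (+-∸-assoc 1 k<n)

guarded-outer : ∀ m ms → GuardedFrom (m ∷ ms) (length ms) ≡ (1 ≤ m + sum ms)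
guarded-outer m ms = cong (λ i → 1 ≤ sum (drop i (m ∷ ms))) (n∸n≡0 (length ms))

shape-tailForm-endless : ∀ m ms k → k < length ms → GuardedFrom ms k →
                         shape (tailForm m ms k) ≡ endless
shape-tailForm-endless m []        k ()  guarded
shape-tailForm-endless m (m′ ∷ ms) k k<n guarded =
  trans (shape-bullets m _) (cong (delay m) (closed (m<1+n⇒m<n∨m≡n k<n)))
  where
  closed : k < length ms ⊎ k ≡ length ms → closeμ (shape (tailForm m′ ms k)) ≡ endless
  closed (inj₁ k<ms) = cong closeμ (shape-tailForm-endless m′ ms k k<ms
                                      (transport id (guarded-inner m′ ms k k<ms) guarded))
  closed (inj₂ refl) = trans (cong closeμ (shape-tailForm-free m′ ms 0))
                             (knot-guarded (m′ + sum ms) (transport id (guarded-outer m′ ms) guarded))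
    where
    knot-guarded : ∀ b → 1 ≤ b → knot b ≡ endless
    knot-guarded (suc b) _ = refl

topVariant⇒endless : ∀ A → IsTopVariant A → shape A ≡ endless
topVariant⇒endless A (m₀ , ms , k , k<n , guarded , tail≡) =
  trans (sym (shape-tl A)) (trans (cong shape tail≡) (shape-tailForm-endless m₀ ms k k<n guarded))

delay1-ends : ∀ s b t → delay 1 s ≡ ends b t → Σ ℕ λ c → (s ≡ ends c t) × (b ≡ suc c)
delay1-ends (ends c t) .(suc c) .t refl = c , refl , refl

delay1-endless : ∀ s → delay 1 s ≡ endless → s ≡ endless
delay1-endless endless _ = refl

closeμ-free : ∀ s b j → closeμ s ≡ ends b (free j) → s ≡ ends b (free (suc j))
closeμ-free endless                    b j ()
closeμ-free (ends b′ unguarded)        b j ()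
closeμ-free (ends zero (free zero))    b j ()
closeμ-free (ends (suc b′) (free zero)) b j ()
closeμ-free (ends b′ (free (suc j′)))  .b′ .j′ refl = refl

closeμ-endless : ∀ s → closeμ s ≡ endless →
                 (s ≡ endless) ⊎ (Σ ℕ λ b → s ≡ ends (suc b) (free 0))
closeμ-endless endless                     _ = inj₁ refl
closeμ-endless (ends b unguarded)          ()
closeμ-endless (ends zero (free zero))     ()
closeμ-endless (ends (suc b) (free zero))  _ = inj₂ (b , refl)
closeμ-endless (ends b (free (suc j)))     ()

ends-free⇒tailForm : ∀ A b j → shape A ≡ ends b (free j) →
  Σ ℕ λ m₀ → Σ (List ℕ) λ ms → (tl A ≡ tailForm m₀ ms (j + length ms)) × (m₀ + sum ms ≡ b)
ends-free⇒tailForm (var n) .0 .n refl = 0 , [] , cong var (sym (+-identityʳ n)) , refl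
ends-free⇒tailForm (A ⇒ B) b j e = ends-free⇒tailForm B b j e
ends-free⇒tailForm (• A) b j e with delay1-ends (shape A) b (free j) e
... | c , eA , refl with ends-free⇒tailForm A c j eA
... | m₀ , ms , tail≡ , count =
  suc m₀ , ms , trans (cong •_ tail≡) (sym (tailForm-suc m₀ ms _)) , cong suc count
ends-free⇒tailForm (μ A) b j e with ends-free⇒tailForm A b (suc j) (closeμ-free (shape A) b j e)
... | m₀ , ms , tail≡ , count =
  0 , m₀ ∷ ms , cong μ (trans tail≡ (cong (tailForm m₀ ms) (sym (+-suc j (length ms))))) , count

endless⇒topVariant : ∀ A → shape A ≡ endless → IsTopVariant A
endless⇒topVariant (var n) ()
endless⇒topVariant (A ⇒ B) e = endless⇒topVariant B e
endless⇒topVariant (• A) e with endless⇒topVariant A (delay1-endless (shape A) e)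
... | m₀ , ms , k , k<n , guarded , tail≡ =
  suc m₀ , ms , k , k<n , guarded , trans (cong •_ tail≡) (sym (tailForm-suc m₀ ms k))
endless⇒topVariant (μ A) e with closeμ-endless (shape A) e
... | inj₁ eA with endless⇒topVariant A eA
...   | m₀ , ms , k , k<n , guarded , tail≡ =
  0 , m₀ ∷ ms , k , m<n⇒m<1+n k<n ,
  transport id (sym (guarded-inner m₀ ms k k<n)) guarded , cong μ tail≡
endless⇒topVariant (μ A) e | inj₂ (b , eA) with ends-free⇒tailForm A (suc b) 0 eA
... | m₀ , ms , tail≡ , count =
  0 , m₀ ∷ ms , length ms , n<1+n (length ms) ,
  transport id (sym (guarded-outer m₀ ms)) (transport (1 ≤_) (sym count) (s≤s z≤n)) ,
  cong μ tail≡

topVariant-subst : ∀ σ B → IsTopVariant B → IsTopVariant (subst σ B)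
topVariant-subst σ B tv = endless⇒topVariant (subst σ B)
  (trans (shape-subst σ B) (cong (λ s → bindShape s _) (topVariant⇒endless B tv)))

endless≢ends : ∀ {b t} → endless ≢ ends b t
endless≢ends ()

proper⇒guarded : ∀ k C → Proper k C → shape C ≢ ends 0 (free k)
proper⇒guarded k (var j) p refl = p refl
proper⇒guarded k (• A) p e = bulleted (shape A) e
  where
  bulleted : ∀ s → delay 1 s ≢ ends 0 (free k)
  bulleted endless    ()
  bulleted (ends c t) ()
proper⇒guarded k (A ⇒ B) (inj₁ (_ , pB)) e = proper⇒guarded k B pB e
proper⇒guarded k (A ⇒ B) (inj₂ tv) e =
  endless≢ends (trans (sym (topVariant⇒endless B tv)) e)
proper⇒guarded k (μ A) (inj₁ p) e = proper⇒guarded (suc k) A p (closeμ-free (shape A) 0 k e)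
proper⇒guarded k (μ A) (inj₂ tv) e =
  endless≢ends (trans (sym (topVariant⇒endless (μ A) tv)) e)

-- Shape-level form of the folding rule μX.A ~ A[μX.A/X].
closeμ-unfold : ∀ s g → g 0 ≡ closeμ s → (∀ n → g (suc n) ≡ ends 0 (free n)) →
                closeμ s ≡ bindShape s g
closeμ-unfold endless            g g0 gs = refl
closeμ-unfold (ends b unguarded) g g0 gs = refl
closeμ-unfold (ends b (free zero)) g g0 gs rewrite g0 = knot-unfold b
  where
  knot-unfold : ∀ b → knot b ≡ delay b (knot b)
  knot-unfold zero    = refl
  knot-unfold (suc b) = refl
closeμ-unfold (ends b (free (suc j))) g g0 gs rewrite gs j =
  cong (λ c → ends c (free j)) (sym (+-identityʳ b))

delay-fixpoint : ∀ b s → s ≡ delay (suc b) s → s ≡ endless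
delay-fixpoint b endless    e = refl
delay-fixpoint b (ends c t) e = ⊥-elim (m≢1+n+m c (cong bulletCount e))
  where
  bulletCount : Shape → ℕ
  bulletCount endless    = 0
  bulletCount (ends c _) = c

-- Shape-level form of the contraction rule: a solution a of a = C[a/X] with
-- C proper in X (so the tail of C is not a bare X) has the shape of μX.C.
closeμ-unique : ∀ a s g → g 0 ≡ a → (∀ n → g (suc n) ≡ ends 0 (free n)) →
                s ≢ ends 0 (free 0) → a ≡ bindShape s g → a ≡ closeμ s
closeμ-unique a endless g g0 gs guarded e = e
closeμ-unique a (ends b unguarded) g g0 gs guarded e = e
closeμ-unique a (ends zero (free zero)) g g0 gs guarded e = ⊥-elim (guarded refl)
closeμ-unique a (ends (suc b) (free zero)) g g0 gs guarded e rewrite g0 = delay-fixpoint b a e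
closeμ-unique a (ends b (free (suc j))) g g0 gs guarded e rewrite gs j =
  trans e (cong (λ c → ends c (free j)) (+-identityʳ b))

shape-invariant : ∀ {r A B} → Eqv r A B → shape A ≡ shape B
shape-invariant (refl′ _)     = refl
shape-invariant (sym′ e)      = sym (shape-invariant e)
shape-invariant (trans′ e f)  = trans (shape-invariant e) (shape-invariant f)
shape-invariant (cong• e)     = cong (delay 1) (shape-invariant e)
shape-invariant (cong⇒ e f)   = shape-invariant f
shape-invariant (arrTop _)    = refl
shape-invariant (fold {A} _ _) =
  trans (closeμ-unfold (shape A) (λ n → shape (sub0 (μ A) n)) refl (λ n → refl))
        (sym (shape-subst (sub0 (μ A)) A))
shape-invariant (contr {A} {C} _ _ p e) =
  closeμ-unique (shape A) (shape C) (λ n → shape (sub0 A n)) refl (λ n → refl)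
    (proper⇒guarded 0 C p) (trans (shape-invariant e) (shape-subst (sub0 A) C))
shape-invariant (dist• _ _ _) = refl

TopOrVar : (ℕ → Ty) → Set
TopOrVar σ = ∀ n → (σ n ≡ Top) ⊎ (Σ ℕ λ m → σ n ≡ var m)

topOrVar-exts : ∀ σ → TopOrVar σ → TopOrVar (exts σ)
topOrVar-exts σ ok zero = inj₂ (0 , refl)
topOrVar-exts σ ok (suc n) with ok n
... | inj₁ e       = inj₁ (cong (rename suc) e)
... | inj₂ (m , e) = inj₂ (suc m , cong (rename suc) e)

TopOrVarBut : ℕ → Ty → Set
TopOrVarBut k t = (t ≡ Top) ⊎ (Σ ℕ λ m → (t ≡ var m) × (m ≢ k))

proper-subst : ∀ A k σ → σ k ≡ var k → (∀ n → n ≢ k → TopOrVarBut k (σ n)) →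
               Proper k A → Proper k (subst σ A)
proper-subst (var n) k σ σk avoid p with avoid n p
... | inj₁ e                rewrite e = inj₁ tt
... | inj₂ (m , e , m≢k)    rewrite e = m≢k
proper-subst (A ⇒ B) k σ σk avoid (inj₁ (pA , pB)) =
  inj₁ (proper-subst A k σ σk avoid pA , proper-subst B k σ σk avoid pB)
proper-subst (A ⇒ B) k σ σk avoid (inj₂ tv) = inj₂ (topVariant-subst σ B tv)
proper-subst (• A) k σ σk avoid p = tt
proper-subst (μ A) k σ σk avoid (inj₁ p) =
  inj₁ (proper-subst A (suc k) (exts σ) (cong (rename suc) σk) avoid′ p)
  where
  avoid′ : ∀ n → n ≢ suc k → TopOrVarBut (suc k) (exts σ n)
  avoid′ zero    _ = inj₂ (0 , refl , λ ())
  avoid′ (suc n) n≢k with avoid n (λ e → n≢k (cong suc e))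
  ... | inj₁ e             = inj₁ (cong (rename suc) e)
  ... | inj₂ (m , e , m≢k) = inj₂ (suc m , cong (rename suc) e , λ e′ → m≢k (suc-injective e′))
proper-subst (μ A) k σ σk avoid (inj₂ tv) = inj₂ (topVariant-subst σ (μ A) tv)

wf-subst : ∀ A σ → TopOrVar σ → WF A → WF (subst σ A)
wf-subst (var n) σ ok w with ok n
... | inj₁ e       rewrite e = tt , tt
... | inj₂ (m , e) rewrite e = tt
wf-subst (A ⇒ B) σ ok (wA , wB) = wf-subst A σ ok wA , wf-subst B σ ok wB
wf-subst (• A)   σ ok w = wf-subst A σ ok w
wf-subst (μ A)   σ ok (p , w) =
  proper-subst A 0 (exts σ) refl avoid p , wf-subst A (exts σ) (topOrVar-exts σ ok) w
  where
  avoid : ∀ n → n ≢ 0 → TopOrVarBut 0 (exts σ n)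
  avoid zero    n≢0 = ⊥-elim (n≢0 refl)
  avoid (suc n) _ with ok n
  ... | inj₁ e       = inj₁ (cong (rename suc) e)
  ... | inj₂ (m , e) = inj₂ (suc m , cong (rename suc) e , λ ())

subst-cong : ∀ A σ τ → (∀ n → σ n ≡ τ n) → subst σ A ≡ subst τ A
subst-cong (var n) σ τ h = h n
subst-cong (A ⇒ B) σ τ h = cong₂ _⇒_ (subst-cong A σ τ h) (subst-cong B σ τ h)
subst-cong (• A)   σ τ h = cong •_ (subst-cong A σ τ h)
subst-cong (μ A)   σ τ h = cong μ (subst-cong A (exts σ) (exts τ) h′)
  where
  h′ : ∀ n → exts σ n ≡ exts τ n
  h′ zero    = refl
  h′ (suc n) = cong (rename suc) (h n)

-- Composition of substitutions, when the first sends variables to ⊤ or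
-- variables (on which renaming and substitution trivially commute).
subst-subst : ∀ A σ τ → TopOrVar σ → subst τ (subst σ A) ≡ subst (λ n → subst τ (σ n)) A
subst-subst (var n) σ τ ok = refl
subst-subst (A ⇒ B) σ τ ok = cong₂ _⇒_ (subst-subst A σ τ ok) (subst-subst B σ τ ok)
subst-subst (• A)   σ τ ok = cong •_ (subst-subst A σ τ ok)
subst-subst (μ A)   σ τ ok =
  cong μ (trans (subst-subst A (exts σ) (exts τ) (topOrVar-exts σ ok)) (subst-cong A _ _ lift))
  where
  lift : ∀ n → subst (exts τ) (exts σ n) ≡ exts (λ n → subst τ (σ n)) n
  lift zero = refl
  lift (suc n) with ok n
  ... | inj₁ e       rewrite e = refl
  ... | inj₂ (m , e) rewrite e = refl

subst-var : ∀ A → subst var A ≡ A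
subst-var (var n) = refl
subst-var (A ⇒ B) = cong₂ _⇒_ (subst-var A) (subst-var B)
subst-var (• A)   = cong •_ (subst-var A)
subst-var (μ A)   = cong μ (trans (subst-cong A (exts var) var exts-var) (subst-var A))
  where
  exts-var : ∀ n → exts var n ≡ var n
  exts-var zero    = refl
  exts-var (suc n) = refl

-- If μX.C has endless shape, so has C[⊤/X].
endless-instantiate : ∀ s g → closeμ s ≡ endless → g 0 ≡ endless → bindShape s g ≡ endless
endless-instantiate endless                    g _  _  = refl
endless-instantiate (ends b unguarded)         g () g0
endless-instantiate (ends zero (free zero))    g () g0
endless-instantiate (ends (suc b) (free zero)) g _  g0 rewrite g0 = refl
endless-instantiate (ends b (free (suc j)))    g () g0

Top-unfold : ∀ {r} → Eqv r Top (• Top)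
Top-unfold = fold (tt , tt) (tt , tt)

endless⇒Top : ∀ {r} A σ → TopOrVar σ → WF A → shape (subst σ A) ≡ endless →
              Eqv r (subst σ A) Top
endless⇒Top {r} (var n) σ ok w e with ok n
... | inj₁ σn≡Top       = transport (λ X → Eqv r X Top) (sym σn≡Top) (refl′ (tt , tt))
... | inj₂ (m , σn≡var) = ⊥-elim (endless≢ends (trans (sym e) (cong shape σn≡var)))
endless⇒Top (A ⇒ B) σ ok (wA , wB) e =
  trans′ (cong⇒ (refl′ (wf-subst A σ ok wA)) (endless⇒Top B σ ok wB e))
         (arrTop (wf-subst A σ ok wA))
endless⇒Top (• A) σ ok w e =
  trans′ (cong• (endless⇒Top A σ ok w (delay1-endless _ e))) (sym′ Top-unfold)
-- For μX.A: with C = σ(A), ⊤ ~ C[⊤/X] by induction, so ⊤ ~ μX.C by contraction.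
endless⇒Top {r} (μ A) σ ok (p , w) e =
  sym′ (contr (tt , tt) (proj₂ wf-μC) (proj₁ wf-μC) Top~C[Top])
  where
  C : Ty
  C = subst (exts σ) A
  wf-μC : WF (μ C)
  wf-μC = wf-subst (μ A) σ ok (p , w)
  -- C[⊤/X] is the instance of A under σ extended by X ↦ ⊤.
  σ⊤ : ℕ → Ty
  σ⊤ n = subst (sub0 Top) (exts σ n)
  ok⊤ : TopOrVar σ⊤
  ok⊤ zero = inj₁ refl
  ok⊤ (suc n) with ok n
  ... | inj₁ e′       = inj₁ (cong (λ t → subst (sub0 Top) (rename suc t)) e′)
  ... | inj₂ (m , e′) = inj₂ (m , cong (λ t → subst (sub0 Top) (rename suc t)) e′)
  C[Top]≡ : C [ Top /0] ≡ subst σ⊤ A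
  C[Top]≡ = subst-subst A (exts σ) (sub0 Top) (topOrVar-exts σ ok)
  C[Top]-endless : shape (subst σ⊤ A) ≡ endless
  C[Top]-endless =
    trans (cong shape (sym C[Top]≡))
          (trans (shape-subst (sub0 Top) C) (endless-instantiate (shape C) _ e refl))
  Top~C[Top] : Eqv r Top (C [ Top /0])
  Top~C[Top] = sym′ (transport (λ X → Eqv r X Top) (sym C[Top]≡)
                                (endless⇒Top A σ⊤ ok⊤ w C[Top]-endless))

theorem4p14 : (r : Rules) (A : Ty) → WF A → (IsTopVariant A ⇔ Eqv r A Top)
theorem4p14 r A w = mk⇔ toTop fromTop
  where
  var-topOrVar : TopOrVar var
  var-topOrVar n = inj₂ (n , refl)

  toTop : IsTopVariant A → Eqv r A Top
  toTop tv = transport (λ X → Eqv r X Top) (subst-var A)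
    (endless⇒Top A var var-topOrVar w (trans (cong shape (subst-var A)) (topVariant⇒endless A tv)))

  fromTop : Eqv r A Top → IsTopVariant A
  fromTop e = endless⇒topVariant A (shape-invariant e)
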